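{- Let $X$ be a finite set. Every closed Condorcet domain $\mathcal{D}\subseteq\mathcal{R}(X)$ is a median domain.
   Context: $\mathcal{R}(X)$ is the set of strict linear orders on $X$. A profile over $\mathcal{D}$ is $(R_1,\dots,R_n)\in\mathcal{D}^n$, odd if $n$ is odd; its majority relation ranks $x$ above $y$ iff more than half of the voters do. $\mathcal{D}$ is a Condorcet domain if the majority relation of every profile over $\mathcal{D}$ is acyclic, and a closed Condorcet domain if moreover the majority relation of every odd profile over $\mathcal{D}$ belongs to $\mathcal{D}$. For $R,R'\in\mathcal{R}(X)$ let $[R,R']=\{Q\in\mathcal{R}(X): Q\supseteq R\cap R'\}$ (Kemeny interval). $\mathcal{D}$ is a median domain if for all $R_1,R_2,R_3\in\mathcal{D}$ there exists $R\in\mathcal{D}$ with $R\in[R_1,R_2]\cap[R_1,R_3]\cap[R_2,R_3]$. -}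

module Defs where

open import Data.Nat using (ℕ; zero; suc; _+_; _*_; _<_)
open import Data.Fin using (Fin; zero; suc)
open import Data.Bool using (Bool; true; false)
open import Data.Product using (Σ; _×_; _,_; ∃; ∃-syntax)
open import Data.Sum using (_⊎_)
open import Relation.Nullary using (¬_)
open import Relation.Binary.PropositionalEquality using (_≡_)
open import Relation.Binary.Construct.Closure.Transitive using (TransClosure)
open import Function.Bundles using (_⇔_)

-- X = Fin m (an arbitrary finite set).
-- A strict linear order on Fin m, given by its (decidable) relation:
-- rel x y ≡ true  means  x is ranked above y.
record LinOrd (m : ℕ) : Set where
  field
    rel     : Fin m → Fin m → Bool
    irrefl  : ∀ x → rel x x ≡ false
    trans   : ∀ x y z → rel x y ≡ true → rel y z ≡ true → rel x z ≡ true
    total   : ∀ x y → ¬ (x ≡ y) → (rel x y ≡ true) ⊎ (rel y x ≡ true)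
open LinOrd public

Domain : ℕ → Set₁
Domain m = LinOrd m → Set

Profile : ∀ {m} → Domain m → ℕ → Set
Profile {m} D n = Σ (Fin n → LinOrd m) (λ P → ∀ i → D (P i))

countTrue : (n : ℕ) → (Fin n → Bool) → ℕ
countTrue zero    f = 0
countTrue (suc n) f with f zero
... | true  = suc (countTrue n (λ i → f (suc i)))
... | false = countTrue n (λ i → f (suc i))

Maj : ∀ {m n} → (Fin n → LinOrd m) → Fin m → Fin m → Set
Maj {m} {n} P x y = n < 2 * countTrue n (λ i → rel (P i) x y)

Acyclic : ∀ {m} → (Fin m → Fin m → Set) → Set
Acyclic {m} R = ∀ x → ¬ TransClosure R x x

Odd : ℕ → Set
Odd n = ∃[ k ] n ≡ suc (2 * k)

IsCondorcetDomain : ∀ {m} → Domain m → Set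
IsCondorcetDomain {m} D =
  ∀ n (P : Profile D n) → Acyclic (Maj (Data.Product.proj₁ P))

_∈ᴿ_ : ∀ {m} → (Fin m → Fin m → Set) → Domain m → Set
_∈ᴿ_ {m} M D = ∃[ Q ] (D Q × (∀ x y → (rel Q x y ≡ true) ⇔ M x y))

IsClosedCondorcetDomain : ∀ {m} → Domain m → Set
IsClosedCondorcetDomain {m} D =
  IsCondorcetDomain D ×
  (∀ n → Odd n → (P : Profile D n) → Maj (Data.Product.proj₁ P) ∈ᴿ D)

-- Kemeny interval: Q ∈ [R , R'] iff Q ⊇ R ∩ R'
_∈[_,_] : ∀ {m} → LinOrd m → LinOrd m → LinOrd m → Set
Q ∈[ R , R' ] = ∀ x y → rel R x y ≡ true → rel R' x y ≡ true → rel Q x y ≡ true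

IsMedianDomain : ∀ {m} → Domain m → Set
IsMedianDomain {m} D =
  ∀ R₁ R₂ R₃ → D R₁ → D R₂ → D R₃ →
  ∃[ R ] (D R × R ∈[ R₁ , R₂ ] × R ∈[ R₁ , R₃ ] × R ∈[ R₂ , R₃ ])

module Submission where

-- Given R₁ R₂ R₃ in D, form the three-voter profile (R₁ , R₂ , R₃).  Three is
-- odd, so closedness yields a member Q of D realising its majority relation.
-- Q is the required median: if two of the three voters rank x above y, then
-- at least 2 of 3 voters do, and 3 < 2 · 2, so the majority (hence Q) ranks
-- x above y.  Thus Q contains R_i ∩ R_j for every pair i ≠ j.

open import Defs
open import Data.Nat using (ℕ; suc; _≤_; s≤s; z≤n)
open import Data.Nat.Properties using (≤-refl; ≤-trans; n≤1+n; *-monoʳ-≤)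
open import Data.Fin using (Fin; zero; suc)
open import Data.Bool using (Bool; true; false)
open import Data.Product using (_,_)
open import Data.Empty using (⊥-elim)
open import Function using (_∘_)
open import Function.Bundles using (Equivalence; _⇔_)
open import Relation.Binary.PropositionalEquality using (_≡_; _≢_; refl; cong)

countTrue-head : ∀ {n} (f : Fin (suc n) → Bool) → f zero ≡ true →
                 countTrue (suc n) f ≡ suc (countTrue n (f ∘ suc))
countTrue-head f fz with f zero
countTrue-head f refl | true = refl

countTrue-tail-≤ : ∀ {n} (f : Fin (suc n) → Bool) →
                   countTrue n (f ∘ suc) ≤ countTrue (suc n) f
countTrue-tail-≤ f with f zero
... | true  = n≤1+n _
... | false = ≤-refl

countTrue-≥1 : ∀ {n} (f : Fin n → Bool) (i : Fin n) → f i ≡ true →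
               1 ≤ countTrue n f
countTrue-≥1 f zero    fi rewrite countTrue-head f fi = s≤s z≤n
countTrue-≥1 f (suc i) fi = ≤-trans (countTrue-≥1 (f ∘ suc) i fi) (countTrue-tail-≤ f)

countTrue-≥2 : ∀ {n} (f : Fin n → Bool) (i j : Fin n) → i ≢ j →
               f i ≡ true → f j ≡ true → 2 ≤ countTrue n f
countTrue-≥2 f zero    zero    i≢j _  _  = ⊥-elim (i≢j refl)
countTrue-≥2 f zero    (suc j) _   fi fj rewrite countTrue-head f fi =
  s≤s (countTrue-≥1 (f ∘ suc) j fj)
countTrue-≥2 f (suc i) zero    _   fi fj rewrite countTrue-head f fj =
  s≤s (countTrue-≥1 (f ∘ suc) i fi)
countTrue-≥2 f (suc i) (suc j) i≢j fi fj =
  ≤-trans (countTrue-≥2 (f ∘ suc) i j (i≢j ∘ cong suc) fi fj) (countTrue-tail-≤ f)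

agreement-of-two⇒majority : ∀ {m} (P : Fin 3 → LinOrd m) (i j : Fin 3) → i ≢ j →
                            ∀ x y → rel (P i) x y ≡ true → rel (P j) x y ≡ true →
                            Maj P x y
agreement-of-two⇒majority P i j i≢j x y hi hj =
  *-monoʳ-≤ 2 (countTrue-≥2 (λ k → rel (P k) x y) i j i≢j hi hj)

majority-in-interval : ∀ {m} (P : Fin 3 → LinOrd m) (Q : LinOrd m) →
                       (∀ x y → (rel Q x y ≡ true) ⇔ Maj P x y) →
                       (i j : Fin 3) → i ≢ j → Q ∈[ P i , P j ]
majority-in-interval P Q Q≡Maj i j i≢j x y hi hj =
  Equivalence.from (Q≡Maj x y) (agreement-of-two⇒majority P i j i≢j x y hi hj)

profile₃ : ∀ {m} → LinOrd m → LinOrd m → LinOrd m → Fin 3 → LinOrd m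
profile₃ R₁ R₂ R₃ zero             = R₁
profile₃ R₁ R₂ R₃ (suc zero)       = R₂
profile₃ R₁ R₂ R₃ (suc (suc zero)) = R₃

corollary2p1 : (m : ℕ) (D : Domain m) → IsClosedCondorcetDomain D → IsMedianDomain D
corollary2p1 m D (_ , closed) R₁ R₂ R₃ d₁ d₂ d₃
  with closed 3 (1 , refl) (profile₃ R₁ R₂ R₃ , voters-in-D)
  where
  voters-in-D : ∀ i → D (profile₃ R₁ R₂ R₃ i)
  voters-in-D zero             = d₁
  voters-in-D (suc zero)       = d₂
  voters-in-D (suc (suc zero)) = d₃
... | Q , Q∈D , Q≡Maj =
  Q , Q∈D , median zero (suc zero) (λ ()) , median zero (suc (suc zero)) (λ ())
          , median (suc zero) (suc (suc zero)) (λ ())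
  where
  median : (i j : Fin 3) → i ≢ j → Q ∈[ profile₃ R₁ R₂ R₃ i , profile₃ R₁ R₂ R₃ j ]
  median = majority-in-interval (profile₃ R₁ R₂ R₃) Q Q≡Maj
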